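{- Let $G=(V,E)$ be a finite undirected graph and $T$ a rooted spanning tree of $G$ with root $r_T$. Let $S=\{x_1,x_2,\dots,x_k\}\subseteq V\setminus\{r_T\}$ be a set of $k\ge 2$ distinct vertices. Then $\gamma(x_1^{\downarrow T},x_2^{\downarrow T},\dots,x_k^{\downarrow T})$ is either equal to $0$ or equal to $\gamma(x_i^{\downarrow T},x_j^{\downarrow T})$ for some $x_i,x_j\in S$.
   Context: $v^{\downarrow T}$ is the set of descendants of $v$ in $T$, including $v$. For $B\subseteq V$, $\delta(B)$ is the set of edges of $G$ with exactly one endpoint in $B$. For vertex sets $A_1,\dots,A_i\subseteq V$, $\gamma(A_1,\dots,A_i)=|\delta(A_1)\cap\delta(A_2)\cap\cdots\cap\delta(A_i)|$. -}

module Defs where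

open import Data.Nat using (ℕ; zero; suc; _<ᵇ_)
open import Data.Fin using (Fin; toℕ; _≟_)
open import Data.Bool using (Bool; true; false; _∧_; _xor_)
open import Data.List using (List; []; _∷_; length; filterᵇ; map; upTo; allFin; cartesianProduct)
open import Data.Bool.ListAction using (all; any)
open import Data.Product using (_×_; _,_)
open import Relation.Binary.PropositionalEquality using (_≡_; _≢_)
open import Relation.Nullary.Decidable using (⌊_⌋)

record Graph (n : ℕ) : Set where
  field
    adj    : Fin n → Fin n → Bool
    sym    : ∀ u v → adj u v ≡ adj v u
    irrefl : ∀ v → adj v v ≡ false
open Graph public

edges : ∀ {n} → Graph n → List (Fin n × Fin n)
edges {n} G = filterᵇ (λ { (u , v) → (toℕ u <ᵇ toℕ v) ∧ adj G u v })
                      (cartesianProduct (allFin n) (allFin n))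

iterate : ∀ {A : Set} → (A → A) → ℕ → A → A
iterate f zero    a = a
iterate f (suc m) a = f (iterate f m a)

-- A rooted spanning tree T of G, given by parent pointers: every non-root
-- vertex v has a parent, {v, parent v} is an edge of G, and a depth function
-- strictly decreases along parent pointers (so following parents always
-- reaches the root, i.e. the tree edges form a spanning tree rooted at root).
record RootedSpanningTree {n : ℕ} (G : Graph n) : Set where
  field
    root         : Fin n
    parent       : Fin n → Fin n
    parent-root  : parent root ≡ root
    depth        : Fin n → ℕ
    depth-parent : ∀ v → v ≢ root → depth v ≡ suc (depth (parent v))
    parent-edge  : ∀ v → v ≢ root → adj G v (parent v) ≡ true
open RootedSpanningTree public

VSet : ℕ → Set
VSet n = Fin n → Bool

-- x^{↓T}: v is a descendant of x (including x itself) iff x = parent^m(v)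
-- for some m.  Any ancestor of v is reached in at most n-1 steps (the path
-- to the root has distinct vertices), so m ranges over 0 … n-1.
desc : ∀ {n} {G : Graph n} → RootedSpanningTree G → Fin n → VSet n
desc {n} T x v = any (λ m → ⌊ iterate (parent T) m v ≟ x ⌋) (upTo n)

inδ : ∀ {n} → VSet n → Fin n × Fin n → Bool
inδ B (u , v) = B u xor B v

γ : ∀ {n} → Graph n → List (VSet n) → ℕ
γ G As = length (filterᵇ (λ e → all (λ A → inδ A e) As) (edges G))

-- If no edge lies in every cut δ(x_l↓), the γ-value is 0.  Otherwise fix such an edge uv.  The
-- descendant sets of non-root vertices form a laminar family (two of them are nested or
-- disjoint), and uv crosses each x_l↓; hence the sides of the cuts that contain u — x_l↓ itself
-- or its complement — form a chain under inclusion.  Since A ⊆ C ⊆ B implies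
-- δ(A) ∩ δ(B) ⊆ δ(C), the cuts of the least and the greatest side of that chain already
-- cut out δ(x_1↓) ∩ ⋯ ∩ δ(x_k↓).
module Submission where

open import Defs
open import Data.Nat using (ℕ; _≤_)
open import Data.Fin using (Fin)
open import Data.List using (List; []; _∷_; map; allFin)
open import Data.Product using (Σ; _×_)
open import Data.Sum using (_⊎_)
open import Relation.Binary.PropositionalEquality using (_≡_; _≢_)
open import Function.Definitions using (Injective)

open import Data.Nat using (zero; suc; _+_; _∸_; _<_)
open import Data.Nat.Properties
  using (+-suc; +-cancelʳ-≡; +-cancelʳ-≤; +-monoʳ-≤; m∸n+n≡m; n≤1+n; ≤-trans; ≤-reflexive)
  renaming (≤-total to ℕ-≤-total)
open import Data.Fin using (toℕ; zero; suc; _≟_)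
open import Data.Fin.Properties using (toℕ-injective; toℕ≤pred[n]; injective⇒≤)
open import Data.Bool using (Bool; true; false; not; _xor_; T; T?; b≤b; f≤t)
  renaming (_≤_ to _≤ᵇ_)
import Data.Bool.Properties as Boolₚ
open import Data.Bool.ListAction using (all)
open import Data.List using (length; filterᵇ; upTo)
open import Data.List.Properties using (filter-≐)
open import Data.List.Membership.Propositional using (_∈_; lose)
open import Data.List.Membership.Propositional.Properties using (∈-upTo⁺; ∈-filter⁻)
open import Data.List.Relation.Unary.All using ([]; _∷_)
open import Data.List.Relation.Unary.All.Properties
  using (all⁺; all⁻; map⁺; map⁻; tabulate⁺; tabulate⁻)
open import Data.List.Relation.Unary.Any using (here; satisfied)
open import Data.List.Relation.Unary.Any.Properties using (any⁺; any⁻)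
open import Data.Product using (_,_; proj₂; ∃-syntax; ∃₂)
open import Data.Sum using (inj₁; inj₂; reduce; swap) renaming (map to map⊎)
open import Data.Empty using (⊥; ⊥-elim)
open import Function using (_∘_; flip; id)
open import Function.Bundles using (module Equivalence)
open import Relation.Binary.Definitions using (Total; Transitive)
open import Relation.Nullary.Decidable using (toWitness; fromWitness; ⌊_⌋)
open import Relation.Binary.PropositionalEquality
  using (refl; cong; subst; subst₂; module ≡-Reasoning)
import Relation.Binary.PropositionalEquality as ≡

open Equivalence using (to; from)

variable
  n k : ℕ

_⊆_ : VSet n → VSet n → Set
A ⊆ B = ∀ t → A t ≤ᵇ B t

⊆-trans : Transitive (_⊆_ {n})
⊆-trans A⊆B B⊆C t = Boolₚ.≤-trans (A⊆B t) (B⊆C t)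

T⇒≤ : ∀ {a b} → (T a → T b) → a ≤ᵇ b
T⇒≤ {false}        _ = Boolₚ.≤-minimum _
T⇒≤ {true} {true}  _ = b≤b
T⇒≤ {true} {false} h = ⊥-elim (h _)

true-false⇒⊈ : {A B : VSet n} {t : Fin n} → A t ≡ true → B t ≡ false → A ⊆ B → ⊥
true-false⇒⊈ {t = t} At Bt A⊆B with () ← subst₂ _≤ᵇ_ At Bt (A⊆B t)

∁ : VSet n → VSet n
∁ A = not ∘ A

not-antimono : ∀ {a b} → a ≤ᵇ b → not b ≤ᵇ not a
not-antimono b≤b = b≤b
not-antimono f≤t = f≤t

∁-antimono : {A B : VSet n} → A ⊆ B → ∁ B ⊆ ∁ A
∁-antimono A⊆B t = not-antimono (A⊆B t)

orient : Bool → VSet n → VSet n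
orient true  A = A
orient false A = ∁ A

inδ-orient : ∀ b (A : VSet n) e → inδ (orient b A) e ≡ inδ A e
inδ-orient true  A e       = refl
inδ-orient false A (u , v) = Boolₚ.xor-annihilates-not (A u) (A v)

xor-between : ∀ {a b c a′ b′ c′} → a ≤ᵇ c → c ≤ᵇ b → a′ ≤ᵇ c′ → c′ ≤ᵇ b′ →
              T (a xor a′) → T (b xor b′) → T (c xor c′)
xor-between {true}  {a′ = true}  _   _   _   _   () _
xor-between {false} {a′ = false} _   _   _   _   () _
xor-between {true}  {a′ = false} b≤b b≤b _   b≤b _  q = q
xor-between {true}  {a′ = false} b≤b b≤b _   f≤t _  _ = _
xor-between {false} {a′ = true}  _   b≤b b≤b b≤b _  q = q
xor-between {false} {a′ = true}  _   f≤t b≤b b≤b _  _ = _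

δ-between : {A B C : VSet n} → A ⊆ C → C ⊆ B →
            ∀ e → T (inδ A e) → T (inδ B e) → T (inδ C e)
δ-between A⊆C C⊆B (u , v) = xor-between (A⊆C u) (C⊆B u) (A⊆C v) (C⊆B v)

xor-≡false : ∀ {a b} → a ≡ false → T (a xor b) → T b
xor-≡false refl h = h

xor-≡true : ∀ {a b} → a ≡ true → T (a xor b) → b ≡ false
xor-≡true {b = false} refl _ = refl

total⇒least : ∀ {ℓ} {R : Fin (suc k) → Fin (suc k) → Set ℓ} →
              Total R → Transitive R → ∃[ i ] (∀ l → R i l)
total⇒least {zero}  total trans = zero , λ { zero → reduce (total zero zero) }
total⇒least {suc k} {R = R} total trans
  with i , i-least ← total⇒least {R = λ l m → R (suc l) (suc m)} (λ l m → total (suc l) (suc m)) trans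
  with total zero (suc i)
... | inj₁ 0≤i = zero  , λ { zero → reduce (total zero zero) ; (suc l) → trans 0≤i (i-least l) }
... | inj₂ i≤0 = suc i , λ { zero → i≤0 ; (suc l) → i-least l }

Laminar : (Fin k → VSet n) → Set
Laminar A = ∀ i j {t} → T (A i t) → T (A j t) → A i ⊆ A j ⊎ A j ⊆ A i

module _ {A : Fin k → VSet n} (laminar : Laminar A) where

  laminar-separated⇒disjoint : ∀ {i j u v} → A i u ≡ true → A j u ≡ false → A j v ≡ true → A i v ≡ false →
                               A i ⊆ ∁ (A j)
  laminar-separated⇒disjoint {i} {j} iu ju jv iv t with A i t in it | A j t in jt
  ... | false | _     = Boolₚ.≤-minimum _
  ... | true  | false = b≤b
  ... | true  | true  with laminar i j (from Boolₚ.T-≡ it) (from Boolₚ.T-≡ jt)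
  ...   | inj₁ Ai⊆Aj = ⊥-elim (true-false⇒⊈ iu ju Ai⊆Aj)
  ...   | inj₂ Aj⊆Ai = ⊥-elim (true-false⇒⊈ jv iv Aj⊆Ai)

  -- orient (A l u) (A l) is the side of the cut δ(A l) that contains u.
  sides-total : ∀ {u v} → (∀ l → T (inδ (A l) (u , v))) →
                Total (λ l m → orient (A l u) (A l) ⊆ orient (A m u) (A m))
  sides-total {u} crossed l m with A l u in lu | A m u in mu
  ... | true  | true  = laminar l m (from Boolₚ.T-≡ lu) (from Boolₚ.T-≡ mu)
  ... | false | false = swap (map⊎ ∁-antimono ∁-antimono
                          (laminar l m (xor-≡false lu (crossed l)) (xor-≡false mu (crossed m))))
  ... | true  | false = inj₁ (laminar-separated⇒disjoint lu mu
                          (to Boolₚ.T-≡ (xor-≡false mu (crossed m))) (xor-≡true lu (crossed l)))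
  ... | false | true  = inj₂ (laminar-separated⇒disjoint mu lu
                          (to Boolₚ.T-≡ (xor-≡false lu (crossed l))) (xor-≡true mu (crossed m)))

laminar-cuts-spanned : {A : Fin (suc k) → VSet n} → Laminar A →
                       ∀ {u v} → (∀ l → T (inδ (A l) (u , v))) →
                       ∃₂ λ i j → ∀ e → T (inδ (A i) e) → T (inδ (A j) e) → ∀ l → T (inδ (A l) e)
laminar-cuts-spanned {A = A} laminar {u} crossed
  with i , i-least    ← total⇒least (sides-total laminar crossed) ⊆-trans
  with j , j-greatest ← total⇒least (flip (sides-total laminar crossed)) (flip ⊆-trans)
  = i , j , λ e ∈δi ∈δj l → subst T (inδ-orient (A l u) (A l) e)
      (δ-between (i-least l) (j-greatest l) e
        (subst T (≡.sym (inδ-orient (A i u) (A i) e)) ∈δi)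
        (subst T (≡.sym (inδ-orient (A j u) (A j) e)) ∈δj))

crossesAll : List (VSet n) → Fin n × Fin n → Bool
crossesAll As e = all (λ A → inδ A e) As

crossesAll⁻ : ∀ {A : Fin k → VSet n} {e} → T (crossesAll (map A (allFin k)) e) → ∀ l → T (inδ (A l) e)
crossesAll⁻ h = tabulate⁻ (map⁻ (all⁺ _ _ h))

crossesAll⁺ : ∀ {A : Fin k → VSet n} {e} → (∀ l → T (inδ (A l) e)) → T (crossesAll (map A (allFin k)) e)
crossesAll⁺ h = all⁻ _ (map⁺ (tabulate⁺ h))

length≡0⊎∈ : ∀ {A : Set} (xs : List A) → length xs ≡ 0 ⊎ ∃[ x ] x ∈ xs
length≡0⊎∈ []      = inj₁ refl
length≡0⊎∈ (x ∷ _) = inj₂ (x , here refl)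

γ≡0⊎crossing-edge : (G : Graph n) (As : List (VSet n)) → γ G As ≡ 0 ⊎ ∃[ e ] T (crossesAll As e)
γ≡0⊎crossing-edge G As =
  map⊎ id (λ (e , e∈) → e , proj₂ (∈-filter⁻ (T? ∘ crossesAll As) {xs = edges G} e∈))
          (length≡0⊎∈ (filterᵇ (crossesAll As) (edges G)))

γ-family≡γ-pair : (G : Graph n) (A : Fin k → VSet n) (i j : Fin k) →
                  (∀ e → T (inδ (A i) e) → T (inδ (A j) e) → ∀ l → T (inδ (A l) e)) →
                  γ G (map A (allFin k)) ≡ γ G (A i ∷ A j ∷ [])
γ-family≡γ-pair G A i j spanned =
  cong length (filter-≐ (T? ∘ crossesAll (map A (allFin _))) (T? ∘ crossesAll (A i ∷ A j ∷ []))
                        (family⇒pair , pair⇒family) (edges G))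
  where
    family⇒pair : ∀ {e} → T (crossesAll (map A (allFin _)) e) → T (crossesAll (A i ∷ A j ∷ []) e)
    family⇒pair {e} h =
      all⁻ (λ B → inδ B e) {xs = A i ∷ A j ∷ []} (crossesAll⁻ h i ∷ crossesAll⁻ h j ∷ [])
    pair⇒family : ∀ {e} → T (crossesAll (A i ∷ A j ∷ []) e) → T (crossesAll (map A (allFin _)) e)
    pair⇒family {e} h with ∈δi ∷ ∈δj ∷ [] ← all⁺ (λ B → inδ B e) (A i ∷ A j ∷ []) h =
      crossesAll⁺ (spanned e ∈δi ∈δj)

iterate-+ : ∀ {A : Set} (f : A → A) a b x → iterate f (a + b) x ≡ iterate f a (iterate f b x)
iterate-+ f zero    b x = refl
iterate-+ f (suc a) b x = cong f (iterate-+ f a b x)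

iterate-fixed : ∀ {A : Set} (f : A → A) {r} → f r ≡ r → ∀ m → iterate f m r ≡ r
iterate-fixed f fr≡r zero    = refl
iterate-fixed f fr≡r (suc m) = ≡.trans (cong f (iterate-fixed f fr≡r m)) fr≡r

module RootedTree {G : Graph n} (tree : RootedSpanningTree G) where

  up : ℕ → Fin n → Fin n
  up = iterate (parent tree)

  up-≢root : ∀ {i j} w → i ≤ j → up j w ≢ root tree → up i w ≢ root tree
  up-≢root {i} {j} w i≤j ≢root up-i≡root = ≢root (begin
    up j w                 ≡⟨ cong (λ m → up m w) (≡.sym (m∸n+n≡m i≤j)) ⟩
    up (j ∸ i + i) w       ≡⟨ iterate-+ (parent tree) (j ∸ i) i w ⟩
    up (j ∸ i) (up i w)    ≡⟨ cong (up (j ∸ i)) up-i≡root ⟩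
    up (j ∸ i) (root tree) ≡⟨ iterate-fixed (parent tree) (parent-root tree) (j ∸ i) ⟩
    root tree              ∎)
    where open ≡-Reasoning

  depth-up : ∀ m w → up m w ≢ root tree → depth tree w ≡ m + depth tree (up m w)
  depth-up zero    w _      = refl
  depth-up (suc m) w ≢root = begin
    depth tree w                         ≡⟨ depth-up m w z≢root ⟩
    m + depth tree z                     ≡⟨ cong (m +_) (depth-parent tree z z≢root) ⟩
    m + suc (depth tree (parent tree z)) ≡⟨ +-suc m _ ⟩
    suc m + depth tree (up (suc m) w)    ∎
    where
      open ≡-Reasoning
      z = up m w
      z≢root = up-≢root w (n≤1+n m) ≢root

  -- w, up 1 w, …, up m w have pairwise distinct depths, so they are m + 1 distinct vertices.
  up-distance<n : ∀ {m w} → up m w ≢ root tree → m < n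
  up-distance<n {m} {w} ≢root = injective⇒≤ {f = λ (i : Fin (suc m)) → up (toℕ i) w} injective
    where
      depth-up′ : ∀ (i : Fin (suc m)) → depth tree w ≡ toℕ i + depth tree (up (toℕ i) w)
      depth-up′ i = depth-up (toℕ i) w (up-≢root w (toℕ≤pred[n] i) ≢root)
      injective : ∀ {i j} → up (toℕ i) w ≡ up (toℕ j) w → i ≡ j
      injective {i} {j} eq = toℕ-injective (+-cancelʳ-≡ _ (toℕ i) (toℕ j)
        (≡.trans (≡.sym (depth-up′ i)) (≡.trans (depth-up′ j) (cong (λ y → toℕ j + depth tree y) (≡.sym eq)))))

  Ancestor : Fin n → Fin n → Set
  Ancestor y w = ∃[ m ] up m w ≡ y

  ancestor-trans : ∀ {x y w} → Ancestor x y → Ancestor y w → Ancestor x w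
  ancestor-trans (a , refl) (b , refl) = a + b , iterate-+ (parent tree) a b _

  ancestors-ordered-by-depth : ∀ {y z w} → y ≢ root tree → z ≢ root tree →
                               Ancestor y w → Ancestor z w → depth tree z ≤ depth tree y → Ancestor z y
  ancestors-ordered-by-depth {w = w} y≢root z≢root (a , refl) (b , refl) dz≤dy =
    b ∸ a , (begin
      up (b ∸ a) (up a w)  ≡⟨ iterate-+ (parent tree) (b ∸ a) a w ⟨
      up (b ∸ a + a) w     ≡⟨ cong (λ m → up m w) (m∸n+n≡m a≤b) ⟩
      up b w               ∎)
    where
      open ≡-Reasoning
      a≤b : a ≤ b
      a≤b = +-cancelʳ-≤ (depth tree (up a w)) a b (≤-trans
              (≤-reflexive (≡.trans (≡.sym (depth-up a w y≢root)) (depth-up b w z≢root)))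
              (+-monoʳ-≤ b dz≤dy))

  desc⇒ancestor : ∀ {y w} → T (desc tree y w) → Ancestor y w
  desc⇒ancestor h with m , p ← satisfied (any⁻ _ (upTo n) h) = m , toWitness p

  ancestor⇒desc : ∀ {y w} → y ≢ root tree → Ancestor y w → T (desc tree y w)
  ancestor⇒desc {w = w} y≢root (m , refl) =
    any⁺ (λ k → ⌊ up k w ≟ up m w ⌋) (lose {x = m} (∈-upTo⁺ (up-distance<n y≢root)) (fromWitness refl))

  desc-antitone : ∀ {y z} → z ≢ root tree → Ancestor z y → desc tree y ⊆ desc tree z
  desc-antitone z≢root z↑y t = T⇒≤ (ancestor⇒desc z≢root ∘ ancestor-trans z↑y ∘ desc⇒ancestor)

  desc-laminar : ∀ {y z w} → y ≢ root tree → z ≢ root tree → T (desc tree y w) → T (desc tree z w) →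
                 desc tree y ⊆ desc tree z ⊎ desc tree z ⊆ desc tree y
  desc-laminar {y} {z} y≢root z≢root y↑w z↑w with ℕ-≤-total (depth tree z) (depth tree y)
  ... | inj₁ dz≤dy = inj₁ (desc-antitone z≢root
          (ancestors-ordered-by-depth y≢root z≢root (desc⇒ancestor y↑w) (desc⇒ancestor z↑w) dz≤dy))
  ... | inj₂ dy≤dz = inj₂ (desc-antitone y≢root
          (ancestors-ordered-by-depth z≢root y≢root (desc⇒ancestor z↑w) (desc⇒ancestor y↑w) dy≤dz))

-- The x_l need not be distinct (i = j is allowed), and k ≥ 1 suffices.
lemma4p1 : {n : ℕ} (G : Graph n) (T : RootedSpanningTree G)
           (k : ℕ) → 2 ≤ k →
           (x : Fin k → Fin n) → Injective _≡_ _≡_ x →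
           (∀ i → x i ≢ root T) →
           (γ G (map (λ i → desc T (x i)) (allFin k)) ≡ 0)
           ⊎ Σ (Fin k) (λ i → Σ (Fin k) (λ j →
               γ G (map (λ i → desc T (x i)) (allFin k))
                 ≡ γ G (desc T (x i) ∷ desc T (x j) ∷ [])))
lemma4p1 G tree (suc k) _ x _ x≢root =
  map⊎ id spanning-pair (γ≡0⊎crossing-edge G (map A (allFin (suc k))))
  where
    open RootedTree tree
    A : Fin (suc k) → VSet _
    A l = desc tree (x l)
    laminar : Laminar A
    laminar i j = desc-laminar (x≢root i) (x≢root j)
    spanning-pair : ∃[ e ] T (crossesAll (map A (allFin (suc k))) e) →
                    ∃₂ λ i j → γ G (map A (allFin (suc k))) ≡ γ G (A i ∷ A j ∷ [])
    spanning-pair ((u , v) , crosses)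
      with i , j , spanned ← laminar-cuts-spanned laminar (crossesAll⁻ crosses)
      = i , j , γ-family≡γ-pair G A i j spanned
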